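{- As formal power series in $q$, \[ \sum_{n=0}^{\infty} z(n)q^n=\prod_{i=1}^{\infty}\frac{1}{1-q^{i(i+1)/2}}. \]
   Context: A partition of a positive integer $n$ is a tuple $\lambda=(n_1,n_2,\dots,n_r)$ of positive integers with $n_1\geq n_2\geq\dots\geq n_r$ and $n_1+\dots+n_r=n$. The cyclicity index of $\lambda$ is $c(\lambda)=\sum_{i=1}^r(3-2i)n_i$. For $m\geq 1$, $z(m)$ is the number of partitions of $2m$ with cyclicity index $0$; by convention $z(0)=1$. -}

module Defs where

open import Data.Nat using (ℕ; zero; suc; _+_; _*_; _∸_; _⊓_; _≤?_)
open import Data.Nat.DivMod using (_/_)
open import Data.Integer as ℤ using (ℤ; +_; _-_)
open import Data.List using (List; []; _∷_; [_]; map; concatMap; applyUpTo; filter; length; upTo)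
open import Data.Nat.ListAction using (sum)
open import Relation.Nullary.Decidable using (does)
open import Data.Bool using (if_then_else_)

-- All partitions of n whose largest part is ≤ k, as weakly decreasing lists of
-- positive integers (n₁ ≥ n₂ ≥ … ≥ n_r).  The first argument is fuel (≥ n suffices,
-- since every part is ≥ 1).
partsBounded : ℕ → ℕ → ℕ → List (List ℕ)
partsBounded _       _ zero    = [ [] ]
partsBounded zero    _ (suc n) = []
partsBounded (suc f) k (suc n) =
  concatMap (λ j → map (j ∷_) (partsBounded f j (suc n ∸ j))) (applyUpTo suc (k ⊓ suc n))

partitions : ℕ → List (List ℕ)
partitions n = partsBounded n n n

-- Cyclicity index c(λ) = Σ_{i=1}^r (3 - 2i) n_i ; the weight w runs through 3-2i.
cycAux : ℤ → List ℕ → ℤ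
cycAux w []       = + 0
cycAux w (x ∷ xs) = w ℤ.* (+ x) ℤ.+ cycAux (w - + 2) xs

cyclicity : List ℕ → ℤ
cyclicity = cycAux (+ 1)

-- z(m) = number of partitions of 2m with cyclicity index 0; z(0) = 1 by convention.
z : ℕ → ℕ
z zero    = 1
z (suc m) = length (filter (λ l → cyclicity l ℤ.≟ + 0) (partitions (2 * suc m)))

Series : Set
Series = ℕ → ℕ

one : Series
one zero    = 1
one (suc _) = 0

-- f / (1 - q^k) = f · Σ_{j≥0} q^{jk}; coefficient of q^n is Σ_{j, jk ≤ n} f(n - jk).
-- (Used only with k ≥ 1, so j ≤ n suffices.)
divGeom : ℕ → Series → Series
divGeom k f n = sum (map (λ j → if does (j * k ≤? n) then f (n ∸ j * k) else 0) (upTo (suc n)))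

tri : ℕ → ℕ
tri i = (i * suc i) / 2

prodTri : ℕ → Series
prodTri zero    = one
prodTri (suc N) = divGeom (tri (suc N)) (prodTri N)

-- Write moment λ = Σ i·nᵢ; then c(λ) = 3|λ| − 2·moment λ, so z(m) counts the partitions
-- of 2m with moment 3m.  Deleting the largest part a of such a partition lowers the moment
-- by 2m and leaves a tail μ with moment m; since moment μ ≥ |μ|, the tail has size at most
-- m ≤ a, so every partition of moment m arises exactly once.  Read by columns, a column of
-- height h contributes h(h+1)/2 to the moment, so partitions of moment m with at most N
-- parts are multisets of the triangular numbers 1, 3, …, N(N+1)/2 summing to m — the
-- q^m-coefficient of the N-th partial product.  Both steps are carried out on the number
-- of partitions in a box with given size and moment, which satisfies a row recursion
-- (split off the largest part) and a column recursion (split off the first column).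

module Submission where

open import Data.Bool using (Bool; true; false; if_then_else_)
open import Data.Integer as ℤ using (ℤ; +_; -[1+_]; 0ℤ)
import Data.Integer.Properties as ℤ
open import Data.Integer.Tactic.RingSolver using (solve-∀)
open import Data.List using (List; []; _∷_; _++_; map; concatMap; applyUpTo; filter; length)
open import Data.Nat as ℕ
  using (ℕ; zero; suc; _+_; _*_; _∸_; _⊓_; _≤_; _<_; _≤′_; z≤n; s≤s; _≤?_)
import Data.Nat.Properties as ℕ
import Data.Nat.Tactic.RingSolver as ℕ-Solver
open import Data.Nat.DivMod using (_/_; m*n/n≡m)
open import Data.Nat.Induction using (<-wellFounded)
open import Data.Nat.ListAction using (sum)
open import Data.Product using (_,_)
open import Data.Sum using (inj₁; inj₂)
open import Function using (_∘_; _⇔_; mk⇔)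
open import Induction.WellFounded using (Acc; acc)
open import Relation.Nullary using (Dec; yes; no; does; ¬_)
open import Relation.Nullary.Decidable using (dec-true; dec-false; does-⇔)
open import Relation.Binary.PropositionalEquality
open import Algebra.Properties.CommutativeSemigroup ℕ.+-commutativeSemigroup using (interchange)
open import Defs

open ≡-Reasoning

∑< : ℕ → (ℕ → ℕ) → ℕ
∑< zero    f = 0
∑< (suc n) f = f 0 + ∑< n (f ∘ suc)

∑<-cong : ∀ n {f g : ℕ → ℕ} → (∀ i → i < n → f i ≡ g i) → ∑< n f ≡ ∑< n g
∑<-cong zero    eq = refl
∑<-cong (suc n) eq = cong₂ _+_ (eq 0 (s≤s z≤n)) (∑<-cong n (λ i i<n → eq (suc i) (s≤s i<n)))

∑<-zero : ∀ n {f : ℕ → ℕ} → (∀ i → i < n → f i ≡ 0) → ∑< n f ≡ 0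
∑<-zero zero    vanish = refl
∑<-zero (suc n) vanish = cong₂ _+_ (vanish 0 (s≤s z≤n)) (∑<-zero n (λ i i<n → vanish (suc i) (s≤s i<n)))

∑<-+ : ∀ n (f g : ℕ → ℕ) → ∑< n (λ i → f i + g i) ≡ ∑< n f + ∑< n g
∑<-+ zero    f g = refl
∑<-+ (suc n) f g = begin
  (f 0 + g 0) + ∑< n (λ i → f (suc i) + g (suc i))
    ≡⟨ cong (_+_ (f 0 + g 0)) (∑<-+ n (f ∘ suc) (g ∘ suc)) ⟩
  (f 0 + g 0) + (∑< n (f ∘ suc) + ∑< n (g ∘ suc))
    ≡⟨ interchange (f 0) (g 0) _ _ ⟩
  (f 0 + ∑< n (f ∘ suc)) + (g 0 + ∑< n (g ∘ suc)) ∎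

∑<-split : ∀ m n (f : ℕ → ℕ) → ∑< (m + n) f ≡ ∑< m f + ∑< n (λ i → f (m + i))
∑<-split zero    n f = refl
∑<-split (suc m) n f = trans (cong (_+_ (f 0)) (∑<-split m n (f ∘ suc))) (sym (ℕ.+-assoc (f 0) _ _))

∑<-snoc : ∀ n (f : ℕ → ℕ) → ∑< (suc n) f ≡ ∑< n f + f n
∑<-snoc n f = begin
  ∑< (suc n) f               ≡⟨ cong (λ m → ∑< m f) (ℕ.+-comm 1 n) ⟩
  ∑< (n + 1) f               ≡⟨ ∑<-split n 1 f ⟩
  ∑< n f + (f (n + 0) + 0)   ≡⟨ cong (_+_ (∑< n f)) (trans (ℕ.+-identityʳ _) (cong f (ℕ.+-identityʳ n))) ⟩
  ∑< n f + f n               ∎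

∑<-truncate : ∀ {m n} (f : ℕ → ℕ) → m ≤ n → (∀ i → m ≤ i → f i ≡ 0) → ∑< n f ≡ ∑< m f
∑<-truncate {m} f m≤n vanish with ℕ.m≤n⇒∃[o]m+o≡n m≤n
... | o , refl = begin
  ∑< (m + o) f                      ≡⟨ ∑<-split m o f ⟩
  ∑< m f + ∑< o (λ i → f (m + i))   ≡⟨ cong (_+_ (∑< m f)) (∑<-zero o (λ i _ → vanish _ (ℕ.m≤m+n m i))) ⟩
  ∑< m f + 0                        ≡⟨ ℕ.+-identityʳ _ ⟩
  ∑< m f                            ∎

∑<-⊓ : ∀ {m} n (f : ℕ → ℕ) → (∀ i → m ≤ i → f i ≡ 0) → ∑< n f ≡ ∑< (n ⊓ m) f
∑<-⊓ {m} n f vanish with ℕ.≤-total n m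
... | inj₁ n≤m rewrite ℕ.m≤n⇒m⊓n≡m n≤m = refl
... | inj₂ m≤n rewrite ℕ.m≥n⇒m⊓n≡n m≤n = ∑<-truncate f m≤n vanish

∑<-reverse : ∀ n (f : ℕ → ℕ) → ∑< (suc n) (λ i → f (n ∸ i)) ≡ ∑< (suc n) f
∑<-reverse zero    f = refl
∑<-reverse (suc n) f = begin
  f (suc n) + ∑< (suc n) (λ i → f (n ∸ i))   ≡⟨ cong (_+_ (f (suc n))) (∑<-reverse n f) ⟩
  f (suc n) + ∑< (suc n) f                   ≡⟨ ℕ.+-comm (f (suc n)) _ ⟩
  ∑< (suc n) f + f (suc n)                   ≡⟨ ∑<-snoc (suc n) f ⟨
  ∑< (suc (suc n)) f                         ∎

∑<-applyUpTo : ∀ n (g f : ℕ → ℕ) → sum (map g (applyUpTo f n)) ≡ ∑< n (g ∘ f)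
∑<-applyUpTo zero    g f = refl
∑<-applyUpTo (suc n) g f = cong (_+_ (g (f 0))) (∑<-applyUpTo n g (f ∘ suc))

sub<0 : ∀ {t n} → t ℤ.< n → t ℤ.- n ℤ.< 0ℤ
sub<0 {t} {n} t<n = subst (t ℤ.- n ℤ.<_) (ℤ.+-inverseʳ n) (ℤ.+-monoˡ-< (ℤ.- n) t<n)

+suc : ∀ m → + suc m ≡ + 1 ℤ.+ + m
+suc = ℤ.pos-+ 1

+[m+n]-m≡n : ∀ m n → + (m + n) ℤ.- + m ≡ + n
+[m+n]-m≡n m n = trans (cong (ℤ._- + m) (ℤ.pos-+ m n)) (cancel (+ m) (+ n))
  where
  cancel : ∀ a b → (a ℤ.+ b) ℤ.- a ≡ b
  cancel = solve-∀

+∸ : ∀ {i n} → i ≤ n → + n ℤ.- + i ≡ + (n ∸ i)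
+∸ {i} {n} i≤n = trans (ℤ.m-n≡m⊖n n i) (ℤ.⊖-≥ i≤n)

triangle : ℕ → ℕ
triangle zero    = 0
triangle (suc i) = suc i + triangle i

+triangle-suc : ∀ m → + triangle (suc m) ≡ + suc m ℤ.+ + triangle m
+triangle-suc m = ℤ.pos-+ (suc m) (triangle m)

triangle-double : ∀ i → triangle i * 2 ≡ i * suc i
triangle-double zero    = refl
triangle-double (suc i) = begin
  (suc i + triangle i) * 2     ≡⟨ ℕ.*-distribʳ-+ 2 (suc i) (triangle i) ⟩
  suc i * 2 + triangle i * 2   ≡⟨ cong (_+_ (suc i * 2)) (triangle-double i) ⟩
  suc i * 2 + i * suc i        ≡⟨ expand i ⟩
  suc i * suc (suc i)          ∎
  where
  expand : ∀ i → suc i * 2 + i * suc i ≡ suc i * suc (suc i)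
  expand = ℕ-Solver.solve-∀

tri≡triangle : ∀ i → tri i ≡ triangle i
tri≡triangle i = trans (cong (_/ 2) (sym (triangle-double i))) (m*n/n≡m (triangle i) 2)

δ : ℤ → ℤ → ℕ
δ (+ zero) (+ zero) = 1
δ _        _        = 0

δ-shift : ∀ a b → δ a (b ℤ.+ a) ≡ δ a b
δ-shift (+ zero)  b = cong (δ (+ zero)) (ℤ.+-identityʳ b)
δ-shift (+ suc _) b = refl
δ-shift -[1+ _ ]  b = refl

δ-reindex : ∀ {a b a′ b′} → a′ ≡ a → b′ ≡ b ℤ.+ a → δ a′ b′ ≡ δ a b
δ-reindex refl refl = δ-shift _ _

δ-moment<size : ∀ {n t} → t ℤ.< n → δ n t ≡ 0
δ-moment<size {+ zero}   {+ _}       (ℤ.+<+ ())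
δ-moment<size {+ zero}   { -[1+ _ ]} _ = refl
δ-moment<size {+ suc _}              _ = refl
δ-moment<size { -[1+ _ ]}            _ = refl

-- boxCount k N n t counts the partitions of n into at most N parts, each at most k, whose
-- moment Σ i·nᵢ is t: either no part equals k, or one is split off, which shifts the
-- indices of the others.  Integer arguments keep it total; a negative size or moment
-- counts nothing.
boxCount : ℕ → ℕ → ℤ → ℤ → ℕ
boxCount zero    N       n t = δ n t
boxCount (suc k) zero    n t = δ n t
boxCount (suc k) (suc N) n t =
  boxCount k (suc N) n t + boxCount (suc k) N (n ℤ.- + suc k) (t ℤ.- n)

boxCount-zeroHeight : ∀ k n t → boxCount k 0 n t ≡ δ n t
boxCount-zeroHeight zero    n t = refl
boxCount-zeroHeight (suc k) n t = refl

boxCount-negSize : ∀ k N {n t} → n ℤ.< 0ℤ → boxCount k N n t ≡ 0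
boxCount-negSize zero    N       { -[1+ _ ]} _   = refl
boxCount-negSize zero    N       {+ _}       (ℤ.+<+ ())
boxCount-negSize (suc k) zero    { -[1+ _ ]} _   = refl
boxCount-negSize (suc k) zero    {+ _}       (ℤ.+<+ ())
boxCount-negSize (suc k) (suc N)             n<0 =
  cong₂ _+_ (boxCount-negSize k (suc N) n<0) (boxCount-negSize (suc k) N (ℤ.+-mono-<-≤ n<0 ℤ.-≤+))

mutual
  boxCount-moment<size : ∀ k N {n t} → t ℤ.< n → boxCount k N n t ≡ 0
  boxCount-moment<size zero    N       t<n = δ-moment<size t<n
  boxCount-moment<size (suc k) zero    t<n = δ-moment<size t<n
  boxCount-moment<size (suc k) (suc N) t<n =
    cong₂ _+_ (boxCount-moment<size k (suc N) t<n) (boxCount-negMoment (suc k) N _ (sub<0 t<n))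

  boxCount-negMoment : ∀ k N n {t} → t ℤ.< 0ℤ → boxCount k N n t ≡ 0
  boxCount-negMoment k N -[1+ _ ] t<0 = boxCount-negSize k N ℤ.-<+
  boxCount-negMoment k N (+ _)    t<0 = boxCount-moment<size k N (ℤ.<-≤-trans t<0 (ℤ.+≤+ z≤n))

boxCount-zeroSize : ∀ k N t → boxCount k N (+ 0) t ≡ δ (+ 0) t
boxCount-zeroSize zero    N       t = refl
boxCount-zeroSize (suc k) zero    t = refl
boxCount-zeroSize (suc k) (suc N) t = begin
  boxCount k (suc N) (+ 0) t + boxCount (suc k) N (+ 0 ℤ.- + suc k) (t ℤ.- + 0)
    ≡⟨ cong₂ _+_ (boxCount-zeroSize k (suc N) t) (boxCount-negSize (suc k) N ℤ.-<+) ⟩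
  δ (+ 0) t + 0
    ≡⟨ ℕ.+-identityʳ _ ⟩
  δ (+ 0) t ∎

boxCount-unroll : ∀ k N n t →
  boxCount k (suc N) n t ≡ δ n t + ∑< k (λ i → boxCount (suc i) N (n ℤ.- + suc i) (t ℤ.- n))
boxCount-unroll zero    N n t = sym (ℕ.+-identityʳ _)
boxCount-unroll (suc k) N n t = begin
  boxCount k (suc N) n t + part k          ≡⟨ cong (λ x → x + part k) (boxCount-unroll k N n t) ⟩
  (δ n t + ∑< k part) + part k             ≡⟨ ℕ.+-assoc (δ n t) _ _ ⟩
  δ n t + (∑< k part + part k)             ≡⟨ cong (_+_ (δ n t)) (∑<-snoc k part) ⟨
  δ n t + ∑< (suc k) part                  ∎
  where
  part : ℕ → ℕ
  part i = boxCount (suc i) N (n ℤ.- + suc i) (t ℤ.- n)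

-- Removing the first column (of height N + 1) lowers the size by N + 1 and the moment
-- by 1 + 2 + ⋯ + (N + 1); this is the conjugate of the defining recursion.
boxCount-column : ∀ k N n t →
  boxCount (suc k) (suc N) n t ≡
  boxCount (suc k) N n t + boxCount k (suc N) (n ℤ.- + suc N) (t ℤ.- + triangle (suc N))
boxCount-column zero zero n t =
  cong (_+_ (δ n t)) (sym (δ-reindex refl (moment≡ t n)))
  where
  moment≡ : ∀ t n → t ℤ.- + 1 ≡ (t ℤ.- n) ℤ.+ (n ℤ.- + 1)
  moment≡ = solve-∀
boxCount-column zero (suc N) n t = begin
  δ n t + boxCount 1 (suc N) (n ℤ.- + 1) (t ℤ.- n)
    ≡⟨ cong (_+_ (δ n t)) (boxCount-column zero N (n ℤ.- + 1) (t ℤ.- n)) ⟩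
  δ n t + (boxCount 1 N (n ℤ.- + 1) (t ℤ.- n) + δ ((n ℤ.- + 1) ℤ.- M) ((t ℤ.- n) ℤ.- T))
    ≡⟨ ℕ.+-assoc (δ n t) _ _ ⟨
  (δ n t + boxCount 1 N (n ℤ.- + 1) (t ℤ.- n)) + δ ((n ℤ.- + 1) ℤ.- M) ((t ℤ.- n) ℤ.- T)
    ≡⟨ cong (_+_ (δ n t + boxCount 1 N (n ℤ.- + 1) (t ℤ.- n))) (sym (δ-reindex size≡ moment≡)) ⟩
  (δ n t + boxCount 1 N (n ℤ.- + 1) (t ℤ.- n)) + δ (n ℤ.- + suc (suc N)) (t ℤ.- + triangle (suc (suc N))) ∎
  where
  M = + suc N
  T = + triangle (suc N)
  size-ring : ∀ n M → n ℤ.- (+ 1 ℤ.+ M) ≡ (n ℤ.- + 1) ℤ.- M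
  size-ring = solve-∀
  moment-ring : ∀ t n M T → t ℤ.- ((+ 1 ℤ.+ M) ℤ.+ T) ≡ ((t ℤ.- n) ℤ.- T) ℤ.+ ((n ℤ.- + 1) ℤ.- M)
  moment-ring = solve-∀
  size≡ : n ℤ.- + suc (suc N) ≡ (n ℤ.- + 1) ℤ.- M
  size≡ = trans (cong (ℤ._-_ n) (+suc (suc N))) (size-ring n M)
  moment≡ : t ℤ.- + triangle (suc (suc N)) ≡ ((t ℤ.- n) ℤ.- T) ℤ.+ ((n ℤ.- + 1) ℤ.- M)
  moment≡ = trans (cong (ℤ._-_ t) (trans (+triangle-suc (suc N)) (cong (ℤ._+ T) (+suc (suc N)))))
                  (moment-ring t n M T)
boxCount-column (suc k) zero n t = begin
  boxCount (suc k) 1 n t + δ (n ℤ.- + suc (suc k)) (t ℤ.- n)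
    ≡⟨ cong (λ b → b + δ (n ℤ.- + suc (suc k)) (t ℤ.- n)) (boxCount-column k zero n t) ⟩
  (δ n t + boxCount k 1 (n ℤ.- + 1) (t ℤ.- + 1)) + δ (n ℤ.- + suc (suc k)) (t ℤ.- n)
    ≡⟨ ℕ.+-assoc (δ n t) _ _ ⟩
  δ n t + (boxCount k 1 (n ℤ.- + 1) (t ℤ.- + 1) + δ (n ℤ.- + suc (suc k)) (t ℤ.- n))
    ≡⟨ cong (λ d → δ n t + (boxCount k 1 (n ℤ.- + 1) (t ℤ.- + 1) + d))
            (cong₂ δ size≡ (moment-ring t n)) ⟩
  δ n t + (boxCount k 1 (n ℤ.- + 1) (t ℤ.- + 1)
           + δ ((n ℤ.- + 1) ℤ.- K) ((t ℤ.- + 1) ℤ.- (n ℤ.- + 1))) ∎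
  where
  K = + suc k
  size-ring : ∀ n K → n ℤ.- (+ 1 ℤ.+ K) ≡ (n ℤ.- + 1) ℤ.- K
  size-ring = solve-∀
  moment-ring : ∀ t n → t ℤ.- n ≡ (t ℤ.- + 1) ℤ.- (n ℤ.- + 1)
  moment-ring = solve-∀
  size≡ : n ℤ.- + suc (suc k) ≡ (n ℤ.- + 1) ℤ.- K
  size≡ = trans (cong (ℤ._-_ n) (+suc (suc k))) (size-ring n K)
boxCount-column (suc k) (suc N) n t = begin
  boxCount (suc k) (suc (suc N)) n t + boxCount (suc (suc k)) (suc N) x y
    ≡⟨ cong₂ _+_ (boxCount-column k (suc N) n t) (boxCount-column (suc k) N x y) ⟩
  (boxCount (suc k) (suc N) n t + boxCount k (suc (suc N)) n′ t′)
    + (boxCount (suc (suc k)) N x y + boxCount (suc k) (suc N) (x ℤ.- M) (y ℤ.- T))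
    ≡⟨ interchange (boxCount (suc k) (suc N) n t) _ _ _ ⟩
  (boxCount (suc k) (suc N) n t + boxCount (suc (suc k)) N x y)
    + (boxCount k (suc (suc N)) n′ t′ + boxCount (suc k) (suc N) (x ℤ.- M) (y ℤ.- T))
    ≡⟨ cong (λ b → (boxCount (suc k) (suc N) n t + boxCount (suc (suc k)) N x y)
                    + (boxCount k (suc (suc N)) n′ t′ + b))
            (cong₂ (boxCount (suc k) (suc N)) size≡ moment≡) ⟩
  (boxCount (suc k) (suc N) n t + boxCount (suc (suc k)) N x y)
    + (boxCount k (suc (suc N)) n′ t′ + boxCount (suc k) (suc N) (n′ ℤ.- K) (t′ ℤ.- n′)) ∎
  where
  K = + suc k
  M = + suc N
  T = + triangle (suc N)
  x = n ℤ.- + suc (suc k)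
  y = t ℤ.- n
  n′ = n ℤ.- + suc (suc N)
  t′ = t ℤ.- + triangle (suc (suc N))
  size-ring : ∀ n K M → (n ℤ.- (+ 1 ℤ.+ K)) ℤ.- M ≡ (n ℤ.- (+ 1 ℤ.+ M)) ℤ.- K
  size-ring = solve-∀
  moment-ring : ∀ t n M T → (t ℤ.- n) ℤ.- T ≡ (t ℤ.- ((+ 1 ℤ.+ M) ℤ.+ T)) ℤ.- (n ℤ.- (+ 1 ℤ.+ M))
  moment-ring = solve-∀
  size≡ : x ℤ.- M ≡ n′ ℤ.- K
  size≡ = trans (cong (λ a → (n ℤ.- a) ℤ.- M) (+suc (suc k)))
         (trans (size-ring n K M) (cong (λ a → (n ℤ.- a) ℤ.- K) (sym (+suc (suc N)))))
  moment≡ : y ℤ.- T ≡ t′ ℤ.- n′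
  moment≡ = begin
    (t ℤ.- n) ℤ.- T
      ≡⟨ moment-ring t n M T ⟩
    (t ℤ.- ((+ 1 ℤ.+ M) ℤ.+ T)) ℤ.- (n ℤ.- (+ 1 ℤ.+ M))
      ≡⟨ cong (λ a → (t ℤ.- (a ℤ.+ T)) ℤ.- (n ℤ.- a)) (+suc (suc N)) ⟨
    (t ℤ.- (+ suc (suc N) ℤ.+ T)) ℤ.- n′
      ≡⟨ cong (λ a → (t ℤ.- a) ℤ.- n′) (+triangle-suc (suc N)) ⟨
    t′ ℤ.- n′ ∎

boxCount-widen : ∀ {s k} N t → s ≤ k → boxCount (suc k) N (+ s) t ≡ boxCount k N (+ s) t
boxCount-widen {s} {k} zero    t s≤k = sym (boxCount-zeroHeight k (+ s) t)
boxCount-widen {s} {k} (suc N) t s≤k = begin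
  boxCount k (suc N) (+ s) t + boxCount (suc k) N (+ s ℤ.- + suc k) (t ℤ.- + s)
    ≡⟨ cong (_+_ (boxCount k (suc N) (+ s) t)) (boxCount-negSize (suc k) N (sub<0 (ℤ.+<+ (s≤s s≤k)))) ⟩
  boxCount k (suc N) (+ s) t + 0
    ≡⟨ ℕ.+-identityʳ _ ⟩
  boxCount k (suc N) (+ s) t ∎

boxCount-heighten : ∀ {s N} k t → s ≤ N → boxCount k (suc N) (+ s) t ≡ boxCount k N (+ s) t
boxCount-heighten         zero    t s≤N = refl
boxCount-heighten {s} {N} (suc k) t s≤N = begin
  boxCount (suc k) (suc N) (+ s) t
    ≡⟨ boxCount-column k N (+ s) t ⟩
  boxCount (suc k) N (+ s) t + boxCount k (suc N) (+ s ℤ.- + suc N) (t ℤ.- + triangle (suc N))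
    ≡⟨ cong (_+_ (boxCount (suc k) N (+ s) t)) (boxCount-negSize k (suc N) (sub<0 (ℤ.+<+ (s≤s s≤N)))) ⟩
  boxCount (suc k) N (+ s) t + 0
    ≡⟨ ℕ.+-identityʳ _ ⟩
  boxCount (suc k) N (+ s) t ∎

boxCount-width-irrelevant : ∀ {s k k′} N t → s ≤ k → s ≤ k′ →
  boxCount k N (+ s) t ≡ boxCount k′ N (+ s) t
boxCount-width-irrelevant {s} N t s≤k s≤k′ =
  trans (toSize (ℕ.≤⇒≤′ s≤k)) (sym (toSize (ℕ.≤⇒≤′ s≤k′)))
  where
  toSize : ∀ {k} → s ≤′ k → boxCount k N (+ s) t ≡ boxCount s N (+ s) t
  toSize ℕ.≤′-refl        = refl
  toSize (ℕ.≤′-step s≤′k) = trans (boxCount-widen N t (ℕ.≤′⇒≤ s≤′k)) (toSize s≤′k)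

boxCount-height-irrelevant : ∀ {s N N′} k t → s ≤ N → s ≤ N′ →
  boxCount k N (+ s) t ≡ boxCount k N′ (+ s) t
boxCount-height-irrelevant {s} k t s≤N s≤N′ =
  trans (toSize (ℕ.≤⇒≤′ s≤N)) (sym (toSize (ℕ.≤⇒≤′ s≤N′)))
  where
  toSize : ∀ {N} → s ≤′ N → boxCount k N (+ s) t ≡ boxCount k s (+ s) t
  toSize ℕ.≤′-refl        = refl
  toSize (ℕ.≤′-step s≤′N) = trans (boxCount-heighten k t (ℕ.≤′⇒≤ s≤′N)) (toSize s≤′N)

-- The partitions into at most N parts with moment t; their size and parts are at most t.
momentCount : ℕ → ℕ → ℕ
momentCount N t = ∑< (suc t) (λ s → boxCount t N (+ s) (+ t))

momentCount-as-sum : ∀ {N t L} (w : ℕ → ℕ) → t < L → (∀ s → s ≤ t → s ≤ w s) →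
  ∑< L (λ s → boxCount (w s) N (+ s) (+ t)) ≡ momentCount N t
momentCount-as-sum {N} {t} {L} w t<L wide = begin
  ∑< L (λ s → boxCount (w s) N (+ s) (+ t))
    ≡⟨ ∑<-truncate _ t<L (λ s t<s → boxCount-moment<size (w s) N (ℤ.+<+ t<s)) ⟩
  ∑< (suc t) (λ s → boxCount (w s) N (+ s) (+ t))
    ≡⟨ ∑<-cong (suc t) (λ s s<1+t →
         boxCount-width-irrelevant N (+ t) (wide s (ℕ.≤-pred s<1+t)) (ℕ.≤-pred s<1+t)) ⟩
  momentCount N t ∎

momentCount-height-irrelevant : ∀ {N N′} t → t ≤ N → t ≤ N′ → momentCount N t ≡ momentCount N′ t
momentCount-height-irrelevant t t≤N t≤N′ = ∑<-cong (suc t) (λ s s<1+t →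
  boxCount-height-irrelevant t (+ t) (ℕ.≤-trans (ℕ.≤-pred s<1+t) t≤N)
                                     (ℕ.≤-trans (ℕ.≤-pred s<1+t) t≤N′))

momentCount-column : ∀ N k → momentCount (suc N) (suc k) ≡ momentCount N (suc k) +
  ∑< (suc (suc k)) (λ s → boxCount k (suc N) (+ s ℤ.- + suc N) (+ suc k ℤ.- + triangle (suc N)))
momentCount-column N k =
  trans (∑<-cong (suc (suc k)) (λ s _ → boxCount-column k N (+ s) (+ suc k)))
        (∑<-+ (suc (suc k)) (λ s → boxCount (suc k) N (+ s) (+ suc k))
                            (λ s → boxCount k (suc N) (+ s ℤ.- + suc N) (+ suc k ℤ.- + triangle (suc N))))

momentCount-column-below : ∀ N t → t < triangle (suc N) → momentCount (suc N) t ≡ momentCount N t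
momentCount-column-below N zero    _   = refl
momentCount-column-below N (suc k) t<T =
  trans (momentCount-column N k) (trans (cong (_+_ (momentCount N (suc k))) noColumn) (ℕ.+-identityʳ _))
  where
  noColumn : ∑< (suc (suc k)) (λ s → boxCount k (suc N) (+ s ℤ.- + suc N) (+ suc k ℤ.- + triangle (suc N)))
             ≡ 0
  noColumn = ∑<-zero (suc (suc k)) (λ s _ →
    boxCount-negMoment k (suc N) (+ s ℤ.- + suc N) (sub<0 (ℤ.+<+ t<T)))

momentCount-column-step : ∀ N u →
  momentCount (suc N) (triangle (suc N) + u) ≡ momentCount N (triangle (suc N) + u) + momentCount (suc N) u
momentCount-column-step N u =
  trans (momentCount-column N k) (cong (_+_ (momentCount N (suc k))) removedColumn)
  where
  k = N + triangle N + u
  L = suc (triangle N + u)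
  part : ℕ → ℕ
  part s = boxCount k (suc N) (+ s ℤ.- + suc N) (+ suc k ℤ.- + triangle (suc N))
  length≡ : suc (suc k) ≡ suc N + L
  length≡ = cong suc (trans (ℕ.+-assoc (suc N) (triangle N) u) (sym (ℕ.+-suc N (triangle N + u))))
  removedColumn : ∑< (suc (suc k)) part ≡ momentCount (suc N) u
  removedColumn = begin
    ∑< (suc (suc k)) part
      ≡⟨ cong (λ m → ∑< m part) length≡ ⟩
    ∑< (suc N + L) part
      ≡⟨ ∑<-split (suc N) L part ⟩
    ∑< (suc N) part + ∑< L (λ i → part (suc N + i))
      ≡⟨ cong₂ _+_ (∑<-zero (suc N) {part} (λ s s<1+N → boxCount-negSize k (suc N) (sub<0 (ℤ.+<+ s<1+N))))
                   (∑<-cong L (λ i _ → cong₂ (boxCount k (suc N)) (+[m+n]-m≡n (suc N) i)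
                                                                 (+[m+n]-m≡n (triangle (suc N)) u))) ⟩
    ∑< L (λ i → boxCount k (suc N) (+ i) (+ u))
      ≡⟨ momentCount-as-sum (λ _ → k) (s≤s (ℕ.m≤n+m u (triangle N)))
                            (λ s s≤u → ℕ.≤-trans s≤u (ℕ.m≤n+m u (N + triangle N))) ⟩
    momentCount (suc N) u ∎

divGeomTerm : ℕ → Series → ℕ → ℕ → ℕ
divGeomTerm k f n j = if does (j * k ≤? n) then f (n ∸ j * k) else 0

divGeom≡∑< : ∀ k f n → divGeom k f n ≡ ∑< (suc n) (divGeomTerm k f n)
divGeom≡∑< k f n = ∑<-applyUpTo (suc n) (divGeomTerm k f n) (λ j → j)

divGeomTerm-in : ∀ k f n j → j * k ≤ n → divGeomTerm k f n j ≡ f (n ∸ j * k)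
divGeomTerm-in k f n j p rewrite dec-true (j * k ≤? n) p = refl

divGeomTerm-out : ∀ k f n j → ¬ (j * k ≤ n) → divGeomTerm k f n j ≡ 0
divGeomTerm-out k f n j p rewrite dec-false (j * k ≤? n) p = refl

divGeom-below : ∀ c f t → t < suc c → divGeom (suc c) f t ≡ f t
divGeom-below c f t t<c = begin
  divGeom (suc c) f t
    ≡⟨ divGeom≡∑< (suc c) f t ⟩
  f t + ∑< t (λ j → divGeomTerm (suc c) f t (suc j))
    ≡⟨ cong (_+_ (f t)) (∑<-zero t (λ j _ → divGeomTerm-out (suc c) f t (suc j) (λ p →
         ℕ.<⇒≱ t<c (ℕ.≤-trans (ℕ.m≤m+n (suc c) _) p)))) ⟩
  f t + 0
    ≡⟨ ℕ.+-identityʳ _ ⟩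
  f t ∎

divGeom-step : ∀ c f u → divGeom (suc c) f (suc c + u) ≡ f (suc c + u) + divGeom (suc c) f u
divGeom-step c f u = begin
  divGeom (suc c) f (suc c + u)
    ≡⟨ divGeom≡∑< (suc c) f (suc c + u) ⟩
  f (suc c + u) + ∑< (suc c + u) (λ j → divGeomTerm (suc c) f (suc c + u) (suc j))
    ≡⟨ cong (_+_ (f (suc c + u))) (∑<-cong (suc c + u) (λ j _ → shiftTerm j)) ⟩
  f (suc c + u) + ∑< (suc c + u) (divGeomTerm (suc c) f u)
    ≡⟨ cong (_+_ (f (suc c + u))) (∑<-truncate _ (s≤s (ℕ.m≤n+m u c)) (λ j u<j →
         divGeomTerm-out (suc c) f u j (λ p → ℕ.<⇒≱ u<j (ℕ.≤-trans (ℕ.m≤m*n j (suc c)) p)))) ⟩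
  f (suc c + u) + ∑< (suc u) (divGeomTerm (suc c) f u)
    ≡⟨ cong (_+_ (f (suc c + u))) (divGeom≡∑< (suc c) f u) ⟨
  f (suc c + u) + divGeom (suc c) f u ∎
  where
  shiftTerm : ∀ j → divGeomTerm (suc c) f (suc c + u) (suc j) ≡ divGeomTerm (suc c) f u j
  shiftTerm j with j * suc c ≤? u
  ... | yes p = trans (divGeomTerm-in (suc c) f (suc c + u) (suc j) (ℕ.+-monoʳ-≤ (suc c) p))
                      (trans (cong f (ℕ.[m+n]∸[m+o]≡n∸o (suc c) u (j * suc c)))
                             (sym (divGeomTerm-in (suc c) f u j p)))
  ... | no ¬p = trans (divGeomTerm-out (suc c) f (suc c + u) (suc j) (¬p ∘ ℕ.+-cancelˡ-≤ (suc c) _ _))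
                      (sym (divGeomTerm-out (suc c) f u j ¬p))

divGeom-unique : ∀ c (f g : Series) → (∀ t → t < suc c → g t ≡ f t) →
  (∀ u → g (suc c + u) ≡ f (suc c + u) + g u) → ∀ t → g t ≡ divGeom (suc c) f t
divGeom-unique c f g below step t = go t (<-wellFounded t)
  where
  go : ∀ t → Acc _<_ t → g t ≡ divGeom (suc c) f t
  go t (acc smaller) with suc c ≤? t
  ... | no  t≱ = trans (below t (ℕ.≰⇒> t≱)) (sym (divGeom-below c f t (ℕ.≰⇒> t≱)))
  ... | yes c≤t with ℕ.m≤n⇒∃[o]m+o≡n c≤t
  ...   | u , refl = begin
    g (suc c + u)
      ≡⟨ step u ⟩
    f (suc c + u) + g u
      ≡⟨ cong (_+_ (f (suc c + u))) (go u (smaller (s≤s (ℕ.m≤n+m u c)))) ⟩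
    f (suc c + u) + divGeom (suc c) f u
      ≡⟨ divGeom-step c f u ⟨
    divGeom (suc c) f (suc c + u) ∎

prodTri≡momentCount : ∀ N t → prodTri N t ≡ momentCount N t
prodTri≡momentCount zero zero    = refl
prodTri≡momentCount zero (suc k) = sym (∑<-zero (suc (suc k)) emptyBox)
  where
  emptyBox : ∀ s → s < suc (suc k) → boxCount (suc k) 0 (+ s) (+ suc k) ≡ 0
  emptyBox zero    _ = refl
  emptyBox (suc _) _ = refl
prodTri≡momentCount (suc N) t = begin
  prodTri (suc N) t
    ≡⟨ cong (λ c → divGeom c (prodTri N) t) (tri≡triangle (suc N)) ⟩
  divGeom (triangle (suc N)) (prodTri N) t
    ≡⟨ divGeom-unique (N + triangle N) (prodTri N) (momentCount (suc N)) below step t ⟨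
  momentCount (suc N) t ∎
  where
  below : ∀ t → t < triangle (suc N) → momentCount (suc N) t ≡ prodTri N t
  below t t<T = trans (momentCount-column-below N t t<T) (sym (prodTri≡momentCount N t))
  step : ∀ u → momentCount (suc N) (triangle (suc N) + u) ≡
               prodTri N (triangle (suc N) + u) + momentCount (suc N) u
  step u = trans (momentCount-column-step N u)
                 (cong (λ m → m + momentCount (suc N) u) (sym (prodTri≡momentCount N _)))

count : {A : Set} → (A → Bool) → List A → ℕ
count p []       = 0
count p (x ∷ xs) = if p x then suc (count p xs) else count p xs

length-filter≡count : ∀ {A : Set} {P : A → Set} (P? : ∀ x → Dec (P x)) xs →
  length (filter P? xs) ≡ count (does ∘ P?) xs
length-filter≡count P? []       = refl
length-filter≡count P? (x ∷ xs) with does (P? x)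
... | true  = cong suc (length-filter≡count P? xs)
... | false = length-filter≡count P? xs

count-++ : ∀ {A : Set} (p : A → Bool) xs ys → count p (xs ++ ys) ≡ count p xs + count p ys
count-++ p []       ys = refl
count-++ p (x ∷ xs) ys with p x
... | true  = cong suc (count-++ p xs ys)
... | false = count-++ p xs ys

count-map : ∀ {A B : Set} (p : B → Bool) (g : A → B) xs → count p (map g xs) ≡ count (p ∘ g) xs
count-map p g []       = refl
count-map p g (x ∷ xs) = cong (λ c → if p (g x) then suc c else c) (count-map p g xs)

count-concatMap : ∀ {A B : Set} (p : B → Bool) (f : A → List B) xs →
  count p (concatMap f xs) ≡ sum (map (count p ∘ f) xs)
count-concatMap p f []       = refl
count-concatMap p f (x ∷ xs) =
  trans (count-++ p (f x) (concatMap f xs)) (cong (_+_ (count p (f x))) (count-concatMap p f xs))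

count-partsBounded : ∀ (p : List ℕ → Bool) f k n → count p (partsBounded (suc f) k (suc n)) ≡
  ∑< (k ⊓ suc n) (λ i → count (p ∘ (suc i ∷_)) (partsBounded f (suc i) (n ∸ i)))
count-partsBounded p f k n = begin
  count p (concatMap firstPart (applyUpTo suc (k ⊓ suc n)))
    ≡⟨ count-concatMap p firstPart (applyUpTo suc (k ⊓ suc n)) ⟩
  sum (map (count p ∘ firstPart) (applyUpTo suc (k ⊓ suc n)))
    ≡⟨ ∑<-applyUpTo (k ⊓ suc n) (count p ∘ firstPart) suc ⟩
  ∑< (k ⊓ suc n) (λ i → count p (map (suc i ∷_) (partsBounded f (suc i) (n ∸ i))))
    ≡⟨ ∑<-cong (k ⊓ suc n) (λ i _ → count-map p (suc i ∷_) (partsBounded f (suc i) (n ∸ i))) ⟩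
  ∑< (k ⊓ suc n) (λ i → count (p ∘ (suc i ∷_)) (partsBounded f (suc i) (n ∸ i))) ∎
  where
  firstPart : ℕ → List (List ℕ)
  firstPart j = map (j ∷_) (partsBounded f j (suc n ∸ j))

<⊓suc⇒≤ : ∀ {i k n} → i < k ⊓ suc n → i ≤ n
<⊓suc⇒≤ {k = k} i<k⊓1+n = ℕ.≤-pred (ℕ.≤-trans i<k⊓1+n (ℕ.m⊓n≤n k _))

sum-∷-∸ : ∀ {i n} l → i ≤ n → sum l ≡ n ∸ i → sum (suc i ∷ l) ≡ suc n
sum-∷-∸ {i} l i≤n sum≡ = cong suc (trans (cong (_+_ i) sum≡) (ℕ.m+[n∸m]≡n i≤n))

count-partsBounded-cong : ∀ f k n (p q : List ℕ → Bool) → (∀ l → sum l ≡ n → p l ≡ q l) →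
  count p (partsBounded f k n) ≡ count q (partsBounded f k n)
count-partsBounded-cong f       k zero    p q agree = cong (λ b → if b then 1 else 0) (agree [] refl)
count-partsBounded-cong zero    k (suc n) p q agree = refl
count-partsBounded-cong (suc f) k (suc n) p q agree = begin
  count p (partsBounded (suc f) k (suc n))
    ≡⟨ count-partsBounded p f k n ⟩
  ∑< (k ⊓ suc n) (λ i → count (p ∘ (suc i ∷_)) (partsBounded f (suc i) (n ∸ i)))
    ≡⟨ ∑<-cong (k ⊓ suc n) (λ i i<k⊓1+n → count-partsBounded-cong f (suc i) (n ∸ i) _ _ (λ l sum≡ →
         agree (suc i ∷ l) (sum-∷-∸ l (<⊓suc⇒≤ {k = k} i<k⊓1+n) sum≡))) ⟩
  ∑< (k ⊓ suc n) (λ i → count (q ∘ (suc i ∷_)) (partsBounded f (suc i) (n ∸ i)))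
    ≡⟨ count-partsBounded q f k n ⟨
  count q (partsBounded (suc f) k (suc n)) ∎

moment : List ℕ → ℕ
moment []       = 0
moment (x ∷ xs) = sum (x ∷ xs) + moment xs

hasMoment : ℤ → List ℕ → Bool
hasMoment t l = does (+ moment l ℤ.≟ t)

hasMoment-∷ : ∀ x l t → hasMoment t (x ∷ l) ≡ hasMoment (t ℤ.- + sum (x ∷ l)) l
hasMoment-∷ x l t = does-⇔ (mk⇔ shift unshift) (+ moment (x ∷ l) ℤ.≟ t) (+ moment l ℤ.≟ t ℤ.- S)
  where
  S = + sum (x ∷ l)
  split : + moment (x ∷ l) ≡ S ℤ.+ + moment l
  split = ℤ.pos-+ (sum (x ∷ l)) (moment l)
  cancel : ∀ a b → b ≡ (a ℤ.+ b) ℤ.- a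
  cancel = solve-∀
  uncancel : ∀ a b → a ℤ.+ (b ℤ.- a) ≡ b
  uncancel = solve-∀
  shift : + moment (x ∷ l) ≡ t → + moment l ≡ t ℤ.- S
  shift eq = trans (cancel S (+ moment l)) (cong (ℤ._- S) (trans (sym split) eq))
  unshift : + moment l ≡ t ℤ.- S → + moment (x ∷ l) ≡ t
  unshift eq = trans split (trans (cong (ℤ._+_ S) eq) (uncancel S t))

hasMoment-[] : ∀ t → (if hasMoment t [] then 1 else 0) ≡ δ (+ 0) t
hasMoment-[] (+ zero)  = refl
hasMoment-[] (+ suc _) = refl
hasMoment-[] -[1+ _ ]  = refl

count-hasMoment : ∀ f k n N t → n ≤ f → n ≤ N →
  count (hasMoment t) (partsBounded f k n) ≡ boxCount k N (+ n) t
count-hasMoment f k zero N t _ _ = trans (hasMoment-[] t) (sym (boxCount-zeroSize k N t))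
count-hasMoment (suc f) k (suc n) (suc N) t (s≤s n≤f) (s≤s n≤N) = begin
  count (hasMoment t) (partsBounded (suc f) k (suc n))
    ≡⟨ count-partsBounded (hasMoment t) f k n ⟩
  ∑< (k ⊓ suc n) (λ i → count (hasMoment t ∘ (suc i ∷_)) (partsBounded f (suc i) (n ∸ i)))
    ≡⟨ ∑<-cong (k ⊓ suc n) (λ i i<k⊓1+n → tails (<⊓suc⇒≤ {k = k} i<k⊓1+n)) ⟩
  ∑< (k ⊓ suc n) firstPart
    ≡⟨ ∑<-⊓ k firstPart (λ i 1+n≤i → boxCount-negSize (suc i) N (sub<0 (ℤ.+<+ (s≤s 1+n≤i)))) ⟨
  ∑< k firstPart
    ≡⟨ boxCount-unroll k N (+ suc n) t ⟨
  boxCount k (suc N) (+ suc n) t ∎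
  where
  firstPart : ℕ → ℕ
  firstPart i = boxCount (suc i) N (+ suc n ℤ.- + suc i) (t ℤ.- + suc n)
  tails : ∀ {i} → i ≤ n → count (hasMoment t ∘ (suc i ∷_)) (partsBounded f (suc i) (n ∸ i)) ≡ firstPart i
  tails {i} i≤n = begin
    count (hasMoment t ∘ (suc i ∷_)) (partsBounded f (suc i) (n ∸ i))
      ≡⟨ count-partsBounded-cong f (suc i) (n ∸ i) _ _ (λ l sum≡ →
           trans (hasMoment-∷ (suc i) l t) (cong (λ s → hasMoment (t ℤ.- + s) l) (sum-∷-∸ l i≤n sum≡))) ⟩
    count (hasMoment (t ℤ.- + suc n)) (partsBounded f (suc i) (n ∸ i))
      ≡⟨ count-hasMoment f (suc i) (n ∸ i) N _ (ℕ.≤-trans (ℕ.m∸n≤m n i) n≤f)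
                                               (ℕ.≤-trans (ℕ.m∸n≤m n i) n≤N) ⟩
    boxCount (suc i) N (+ (n ∸ i)) (t ℤ.- + suc n)
      ≡⟨ cong (λ s → boxCount (suc i) N s (t ℤ.- + suc n)) (+∸ (s≤s i≤n)) ⟨
    firstPart i ∎

cycAux≡ : ∀ w l → cycAux w l ≡ (w ℤ.+ + 2) ℤ.* + sum l ℤ.- + 2 ℤ.* + moment l
cycAux≡ w []       = empty w
  where
  empty : ∀ w → + 0 ≡ (w ℤ.+ + 2) ℤ.* + 0 ℤ.- + 2 ℤ.* + 0
  empty = solve-∀
cycAux≡ w (x ∷ xs) = begin
  w ℤ.* + x ℤ.+ cycAux (w ℤ.- + 2) xs
    ≡⟨ cong (ℤ._+_ (w ℤ.* + x)) (cycAux≡ (w ℤ.- + 2) xs) ⟩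
  w ℤ.* + x ℤ.+ ((w ℤ.- + 2 ℤ.+ + 2) ℤ.* S ℤ.- + 2 ℤ.* M)
    ≡⟨ regroup w (+ x) S M ⟩
  (w ℤ.+ + 2) ℤ.* (+ x ℤ.+ S) ℤ.- + 2 ℤ.* ((+ x ℤ.+ S) ℤ.+ M)
    ≡⟨ cong₂ (λ a b → (w ℤ.+ + 2) ℤ.* a ℤ.- + 2 ℤ.* b)
             sum≡ (trans (ℤ.pos-+ (x + sum xs) (moment xs)) (cong (ℤ._+ M) sum≡)) ⟨
  (w ℤ.+ + 2) ℤ.* + sum (x ∷ xs) ℤ.- + 2 ℤ.* + moment (x ∷ xs) ∎
  where
  S = + sum xs
  M = + moment xs
  sum≡ : + sum (x ∷ xs) ≡ + x ℤ.+ S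
  sum≡ = ℤ.pos-+ x (sum xs)
  regroup : ∀ w x S M → w ℤ.* x ℤ.+ ((w ℤ.- + 2 ℤ.+ + 2) ℤ.* S ℤ.- + 2 ℤ.* M) ≡
                        (w ℤ.+ + 2) ℤ.* (x ℤ.+ S) ℤ.- + 2 ℤ.* ((x ℤ.+ S) ℤ.+ M)
  regroup = solve-∀

cyclicity≡ : ∀ l → cyclicity l ≡ + (3 * sum l) ℤ.- + (2 * moment l)
cyclicity≡ l = trans (cycAux≡ (+ 1) l) (sym (cong₂ ℤ._-_ (ℤ.pos-* 3 (sum l)) (ℤ.pos-* 2 (moment l))))

cyclicity≡0⇔ : ∀ {M} l → sum l ≡ 2 * M → (cyclicity l ≡ + 0) ⇔ (+ moment l ≡ + (3 * M))
cyclicity≡0⇔ {M} l sum≡ = mk⇔ forward backward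
  where
  3S≡6M : 3 * sum l ≡ 2 * (3 * M)
  3S≡6M = trans (cong (_*_ 3) sum≡) (reorder M)
    where
    reorder : ∀ M → 3 * (2 * M) ≡ 2 * (3 * M)
    reorder = ℕ-Solver.solve-∀
  forward : cyclicity l ≡ + 0 → + moment l ≡ + (3 * M)
  forward cyc≡0 = cong +_ (ℕ.*-cancelˡ-≡ (moment l) (3 * M) 2 (trans 2m≡3S 3S≡6M))
    where
    2m≡3S : 2 * moment l ≡ 3 * sum l
    2m≡3S = ℤ.+-injective (sym (ℤ.i-j≡0⇒i≡j _ _ (trans (sym (cyclicity≡ l)) cyc≡0)))
  backward : + moment l ≡ + (3 * M) → cyclicity l ≡ + 0
  backward m≡3M = begin
    cyclicity l                          ≡⟨ cyclicity≡ l ⟩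
    + (3 * sum l) ℤ.- + (2 * moment l)   ≡⟨ cong (λ a → + (3 * sum l) ℤ.- + (2 * a)) (ℤ.+-injective m≡3M) ⟩
    + (3 * sum l) ℤ.- + (2 * (3 * M))    ≡⟨ cong (λ a → + (3 * sum l) ℤ.- + a) 3S≡6M ⟨
    + (3 * sum l) ℤ.- + (3 * sum l)      ≡⟨ ℤ.+-inverseʳ (+ (3 * sum l)) ⟩
    + 0                                  ∎

z≡count-hasMoment : ∀ m → z (suc m) ≡ count (hasMoment (+ (3 * suc m))) (partitions (2 * suc m))
z≡count-hasMoment m = trans (length-filter≡count (λ l → cyclicity l ℤ.≟ + 0) (partitions n))
  (count-partsBounded-cong n n n _ _ (λ l sum≡ →
    does-⇔ (cyclicity≡0⇔ {suc m} l sum≡) (cyclicity l ℤ.≟ + 0) (+ moment l ℤ.≟ _)))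
  where
  n = 2 * suc m

-- Since 2t ≤ n + 1, a tail of size s ≤ t sits below a first part n + 1 − s ≥ s, so the
-- bound that the first part imposes on the tail is no restriction.
boxCount-dropFirstPart : ∀ {N} n t → 2 * t ≤ suc n → t ≤ N →
  boxCount (suc n) (suc n) (+ suc n) (+ (suc n + t)) ≡ momentCount N t
boxCount-dropFirstPart {N} n t 2t≤1+n t≤N = begin
  boxCount (suc n) (suc n) (+ suc n) (+ (suc n + t))
    ≡⟨ boxCount-unroll (suc n) n (+ suc n) (+ (suc n + t)) ⟩
  ∑< (suc n) (λ i → boxCount (suc i) n (+ suc n ℤ.- + suc i) (+ (suc n + t) ℤ.- + suc n))
    ≡⟨ ∑<-cong (suc n) (λ i i<1+n → cong₂ (boxCount (suc i) n) (+∸ i<1+n) (+[m+n]-m≡n (suc n) t)) ⟩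
  ∑< (suc n) (λ i → boxCount (suc i) n (+ (n ∸ i)) (+ t))
    ≡⟨ ∑<-cong (suc n) (λ i i<1+n →
         cong (λ k → boxCount k n (+ (n ∸ i)) (+ t)) (firstPart≡ (ℕ.≤-pred i<1+n))) ⟩
  ∑< (suc n) (λ i → tailCount (n ∸ i))
    ≡⟨ ∑<-reverse n tailCount ⟩
  ∑< (suc n) tailCount
    ≡⟨ momentCount-as-sum (λ s → suc n ∸ s) (s≤s t≤n) wide ⟩
  momentCount n t
    ≡⟨ momentCount-height-irrelevant t t≤n t≤N ⟩
  momentCount N t ∎
  where
  tailCount : ℕ → ℕ
  tailCount s = boxCount (suc n ∸ s) n (+ s) (+ t)
  firstPart≡ : ∀ {i} → i ≤ n → suc i ≡ suc n ∸ (n ∸ i)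
  firstPart≡ {i} i≤n = sym (trans (ℕ.+-∸-assoc 1 (ℕ.m∸n≤m n i)) (cong suc (ℕ.m∸[m∸n]≡n i≤n)))
  t+t≤1+n : t + t ≤ suc n
  t+t≤1+n = subst (_≤ suc n) (cong (_+_ t) (ℕ.+-identityʳ t)) 2t≤1+n
  t≤n : t ≤ n
  t≤n = half t+t≤1+n
    where
    half : ∀ {t} → t + t ≤ suc n → t ≤ n
    half {zero}  _             = z≤n
    half {suc t} (s≤s t+1+t≤n) = ℕ.m+n≤o⇒n≤o t t+1+t≤n
  wide : ∀ s → s ≤ t → s ≤ suc n ∸ s
  wide s s≤t = ℕ.m+n≤o⇒m≤o∸n s (ℕ.≤-trans (ℕ.+-mono-≤ s≤t s≤t) t+t≤1+n)

corollary5p3 : (N n : ℕ) → n ≤ N → z n ≡ prodTri N n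
corollary5p3 N zero    _   = sym (prodTri≡momentCount N 0)
corollary5p3 N (suc m) m<N = begin
  z M
    ≡⟨ z≡count-hasMoment m ⟩
  count (hasMoment (+ (3 * M))) (partitions (2 * M))
    ≡⟨ count-hasMoment (2 * M) (2 * M) (2 * M) (2 * M) _ ℕ.≤-refl ℕ.≤-refl ⟩
  boxCount (2 * M) (2 * M) (+ (2 * M)) (+ (3 * M))
    ≡⟨ cong (λ t → boxCount (2 * M) (2 * M) (+ (2 * M)) (+ t)) (3M≡2M+M m) ⟩
  boxCount (2 * M) (2 * M) (+ (2 * M)) (+ (2 * M + M))
    ≡⟨ boxCount-dropFirstPart _ M ℕ.≤-refl m<N ⟩
  momentCount N M
    ≡⟨ prodTri≡momentCount N M ⟨
  prodTri N M ∎
  where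
  M = suc m
  3M≡2M+M : ∀ m → 3 * suc m ≡ 2 * suc m + suc m
  3M≡2M+M = ℕ-Solver.solve-∀
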